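{- Let $G$ be a well-covered graph with $r=\alpha(G)$. Then \[\operatorname{w}(G)=\min_{S\in\Omega^*(G),\ |S|=r-1}|F_G(S)|.\] Equivalently, if $H=\overline G$, then $\operatorname{w}(G)=\delta^{\mathrm{cl}}_{r-1}(H)$.
   Context: All graphs are finite, simple and non-empty. $\Omega^*(G)$ is the family of independent sets of $G$, $\alpha(G)$ the independence number, $\Omega(G)$ the family of maximum independent sets. $G$ is well-covered if every maximal independent set has cardinality $\alpha(G)$. For $p\ge1$, $G\in\mathbf W_p$ means: $|V(G)|\ge p$ and any $p$ pairwise disjoint independent sets $A_1,\dots,A_p$ can be extended to pairwise disjoint maximum independent sets $M_1\supseteq A_1,\dots,M_p\supseteq A_p$. For well-covered $G$, $\operatorname{w}(G)=\max\{p\ge1: G\in\mathbf W_p\}$. For independent $S$ with $|S|=\alpha(G)-1$, $F_G(S)=\{x\in V(G)\setminus S: S\cup\{x\}\in\Omega(G)\}$. $\overline G$ is the complement graph. For a graph $H$, $\mathcal K_t(H)$ is the family of vertex sets inducing $K_t$; for $Q\in\mathcal K_{r-1}(H)$, $\operatorname{codeg}_H(Q)=|\{x\in V(H)\setminus Q: Q\cup\{x\}\in\mathcal K_r(H)\}|$, and $\delta^{\mathrm{cl}}_{r-1}(H)=\min\{\operatorname{codeg}_H(Q):Q\in\mathcal K_{r-1}(H)\}$, with the convention $\mathcal K_0(H)=\{\emptyset\}$ and $\delta^{\mathrm{cl}}_0(H)=|V(H)|$. -}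

module Defs where

open import Data.Nat using (ℕ; _≤_; _∸_)
open import Data.Bool using (Bool; false)
open import Data.Fin using (Fin)
open import Data.Fin.Subset using (Subset; _∈_; _∉_; _⊆_; ⁅_⁆; _∪_; ∣_∣)
open import Data.Product using (Σ; _×_; ∃)
open import Data.Empty using (⊥)
open import Relation.Binary.PropositionalEquality using (_≡_; _≢_)
open import Function.Bundles using (_⇔_)

-- A finite simple graph on the vertex set Fin n (adjacency as a Bool-valued
-- symmetric irreflexive relation).  Non-emptiness (n ≥ 1) is a separate hypothesis.
record Graph (n : ℕ) : Set where
  field
    adj   : Fin n → Fin n → Bool
    sym   : ∀ x y → adj x y ≡ adj y x
    irrefl : ∀ x → adj x x ≡ false
open Graph public

module _ {n : ℕ} (G : Graph n) where

  Independent : Subset n → Set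
  Independent S = ∀ x y → x ∈ S → y ∈ S → adj G x y ≡ false

  MaximalIndependent : Subset n → Set
  MaximalIndependent S = Independent S × (∀ x → x ∉ S → Independent (⁅ x ⁆ ∪ S) → ⊥)

  IndependenceNumber : ℕ → Set
  IndependenceNumber r =
    Σ (Subset n) (λ S → Independent S × ∣ S ∣ ≡ r) × (∀ S → Independent S → ∣ S ∣ ≤ r)

  MaximumIndependent : ℕ → Subset n → Set
  MaximumIndependent r S = Independent S × ∣ S ∣ ≡ r

  WellCovered : ℕ → Set
  WellCovered r = ∀ S → MaximalIndependent S → ∣ S ∣ ≡ r

  Disjoint : Subset n → Subset n → Set
  Disjoint A B = ∀ x → x ∈ A → x ∈ B → ⊥

  InW : ℕ → ℕ → Set
  InW r p = p ≤ n ×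
    ((A : Fin p → Subset n) → (∀ i → Independent (A i)) →
      (∀ i j → i ≢ j → Disjoint (A i) (A j)) →
      Σ (Fin p → Subset n) λ M →
        (∀ i → MaximumIndependent r (M i)) × (∀ i → A i ⊆ M i) ×
        (∀ i j → i ≢ j → Disjoint (M i) (M j)))

  IsWNumber : ℕ → ℕ → Set
  IsWNumber r m = 1 ≤ m × InW r m × (∀ p → 1 ≤ p → InW r p → p ≤ m)

  IsF : ℕ → Subset n → Subset n → Set
  IsF r S T = ∀ x → x ∈ T ⇔ (x ∉ S × MaximumIndependent r (⁅ x ⁆ ∪ S))

  IsMinF : ℕ → ℕ → Set
  IsMinF r m =
    Σ (Subset n) (λ S → Σ (Subset n) λ T →
      Independent S × ∣ S ∣ ≡ r ∸ 1 × IsF r S T × ∣ T ∣ ≡ m) ×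
    (∀ S T → Independent S → ∣ S ∣ ≡ r ∸ 1 → IsF r S T → m ≤ ∣ T ∣)

{-# OPTIONS --safe #-}
-- Write α for α(G) and m for the least ∣ F(S) ∣ over independent S with ∣ S ∣ = α − 1.
-- Each F(S) is a clique, and it meets every maximum independent superset of S (by
-- well-coveredness such supersets exist). If p ≤ m, disjoint independent sets A₁, …, A_p
-- are grown one vertex at a time into maximum ones: a growing Aᵢ with fewer than α
-- vertices lies inside some S with ∣ S ∣ = α − 1, and the clique F(S) has at most one
-- vertex in each of the other p − 1 sets, so one of its ≥ p vertices can be added to Aᵢ.
-- Conversely, a minimising S together with the m singletons of F(S) cannot be extended to
-- m + 1 disjoint maximum independent sets, since the one containing S meets F(S).
module Submission where

open import Defs hiding (sym)
open import Data.Bool using (false)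
open import Data.Empty using (⊥-elim)
import Data.Bool.Properties as Bool
open import Data.Fin using (Fin; zero; suc; toℕ; fromℕ<; punchIn; punchOut)
open import Data.Fin.Properties
  using (any?; all?; punchIn-punchOut; toℕ-injective; toℕ-fromℕ<)
  renaming (_≟_ to _≟ᶠ_)
open import Data.Fin.Subset
  using (Subset; _∈_; _∉_; _⊆_; ⁅_⁆; _∪_; _∩_; _─_; _-_; ∣_∣; ⊥; Nonempty; inside; outside)
open import Data.Fin.Subset.Properties
  using ( _∈?_; ∉⊥; ∣⊥∣≡0; ∣p∣≤n; x∈⁅x⁆; x∈⁅y⁆⇒x≡y; x∉⁅y⁆⇒x≢y; ∣⁅x⁆∣≡1; ⊆-refl; ⊆-antisym
        ; p⊆q⇒∣p∣≤∣q∣; x∈p∩q⁺; x∈p∩q⁻; q⊆p∪q; x∈p∪q⁺; x∈p∪q⁻; ∪-identityˡ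
        ; p─⊥≡p; p─q⊆p; x∈p∧x≢y⇒x∈p-y; anySubset?)
open import Data.List using (List; []; _∷_; allFin)
open import Data.List.Membership.Propositional.Properties using (∈-allFin)
open import Data.List.Relation.Unary.All as All using (All; []; _∷_)
open import Data.Nat using (ℕ; zero; suc; _≤_; _<_; _∸_; z≤n; s≤s; _<?_)
import Data.Nat as ℕ
open import Data.Nat.Properties
  using (≤-refl; ≤-reflexive; ≤-antisym; <-≤-trans; <⇒≤; <⇒≱; ≮⇒≥; ≤∧≢⇒<; ≤-pred; ∸-monoʳ-<; suc-injective)
open import Data.Nat.Induction using (<-wellFounded)
open import Data.Product using (∃; _×_; _,_; proj₁; proj₂)
open import Data.Sum using (_⊎_; inj₁; inj₂; [_,_]′)
import Data.Sum as Sum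
open import Data.Vec.Base using ([]; _∷_; here; there)
open import Data.Vec.Functional using (updateAt)
open import Data.Vec.Functional.Properties using (updateAt-updates; updateAt-minimal)
open import Function using (_∘_; const)
open import Function.Bundles using (mk⇔; Equivalence)
open import Level using (Level)
open import Induction.WellFounded using (Acc; acc)
open import Relation.Binary.PropositionalEquality
  using (_≡_; _≢_; refl; sym; trans; cong; subst; subst₂)
open import Relation.Nullary using (¬_; Dec; yes; no; does; contradiction)
open import Relation.Nullary.Decidable using (_×-dec_; _→-dec_; ¬?; decidable-stable)
open import Relation.Unary using (Pred; Decidable)

private
  variable
    ℓ : Level
    n k : ℕ

x∉p⇒∣⁅x⁆∪p∣≡1+∣p∣ : ∀ {x : Fin n} {p} → x ∉ p → ∣ ⁅ x ⁆ ∪ p ∣ ≡ suc ∣ p ∣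
x∉p⇒∣⁅x⁆∪p∣≡1+∣p∣ {x = zero}  {inside  ∷ p} x∉p = contradiction here x∉p
x∉p⇒∣⁅x⁆∪p∣≡1+∣p∣ {x = zero}  {outside ∷ p} _   = cong (suc ∘ ∣_∣) (∪-identityˡ p)
x∉p⇒∣⁅x⁆∪p∣≡1+∣p∣ {x = suc x} {inside  ∷ p} x∉p = cong suc (x∉p⇒∣⁅x⁆∪p∣≡1+∣p∣ (x∉p ∘ there))
x∉p⇒∣⁅x⁆∪p∣≡1+∣p∣ {x = suc x} {outside ∷ p} x∉p = x∉p⇒∣⁅x⁆∪p∣≡1+∣p∣ (x∉p ∘ there)

x∈p⇒∣p∣≡1+∣p-x∣ : ∀ {x : Fin n} {p} → x ∈ p → ∣ p ∣ ≡ suc ∣ p - x ∣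
x∈p⇒∣p∣≡1+∣p-x∣ {p = inside ∷ p}  here        = cong (suc ∘ ∣_∣) (sym (p─⊥≡p p))
x∈p⇒∣p∣≡1+∣p-x∣ {p = inside ∷ p}  (there x∈p) = cong suc (x∈p⇒∣p∣≡1+∣p-x∣ x∈p)
x∈p⇒∣p∣≡1+∣p-x∣ {p = outside ∷ p} (there x∈p) = x∈p⇒∣p∣≡1+∣p-x∣ x∈p

x∈p─q⇒x∉q : ∀ {x : Fin n} {p q} → x ∈ p ─ q → x ∉ q
x∈p─q⇒x∉q {p = inside ∷ _}  {outside ∷ _} here        ()
x∈p─q⇒x∉q {p = _ ∷ _}       {_ ∷ _}       (there x∈) (there x∈q) = x∈p─q⇒x∉q x∈ x∈q

∣p∣<∣q∣⇒∃∈q∉p : ∀ {p q : Subset n} → ∣ p ∣ < ∣ q ∣ → ∃ λ x → x ∈ q × x ∉ p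
∣p∣<∣q∣⇒∃∈q∉p {p = p} {q} ∣p∣<∣q∣ with any? (λ x → x ∈? q ×-dec ¬? (x ∈? p))
... | yes found = found
... | no ∄x = contradiction (p⊆q⇒∣p∣≤∣q∣ q⊆p) (<⇒≱ ∣p∣<∣q∣)
  where
  q⊆p : q ⊆ p
  q⊆p {x} x∈q = decidable-stable (x ∈? p) (λ x∉p → ∄x (x , x∈q , x∉p))

0<∣p∣⇒Nonempty : ∀ {p : Subset n} → 0 < ∣ p ∣ → Nonempty p
0<∣p∣⇒Nonempty {n} {p} 0<∣p∣ =
  let x , x∈p , _ = ∣p∣<∣q∣⇒∃∈q∉p {p = ⊥} (subst (_< ∣ p ∣) (sym (∣⊥∣≡0 n)) 0<∣p∣) in x , x∈p

x∈p⇒0<∣p∣ : ∀ {x : Fin n} {p} → x ∈ p → 0 < ∣ p ∣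
x∈p⇒0<∣p∣ {x = x} {p} x∈p = subst (_≤ ∣ p ∣) (∣⁅x⁆∣≡1 x) (p⊆q⇒∣p∣≤∣q∣ ⁅x⁆⊆p)
  where
  ⁅x⁆⊆p : ⁅ x ⁆ ⊆ p
  ⁅x⁆⊆p y∈⁅x⁆ = subst (_∈ p) (sym (x∈⁅y⁆⇒x≡y x y∈⁅x⁆)) x∈p

x∈⁅x⁆∪p : ∀ (x : Fin n) {p} → x ∈ ⁅ x ⁆ ∪ p
x∈⁅x⁆∪p x = x∈p∪q⁺ (inj₁ (x∈⁅x⁆ x))

x∈⁅y⁆∪p⁻ : ∀ {x y : Fin n} {p} → x ∈ ⁅ y ⁆ ∪ p → x ≡ y ⊎ x ∈ p
x∈⁅y⁆∪p⁻ {y = y} {p} = Sum.map₁ (x∈⁅y⁆⇒x≡y y) ∘ x∈p∪q⁻ ⁅ y ⁆ p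

x∉⁅y⁆∪p : ∀ {x y : Fin n} {p} → x ≢ y → x ∉ p → x ∉ ⁅ y ⁆ ∪ p
x∉⁅y⁆∪p x≢y x∉p = [ x≢y , x∉p ]′ ∘ x∈⁅y⁆∪p⁻

⁅x⁆∪p⊆q : ∀ {x : Fin n} {p q} → x ∈ q → p ⊆ q → ⁅ x ⁆ ∪ p ⊆ q
⁅x⁆∪p⊆q x∈q p⊆q z∈ with x∈⁅y⁆∪p⁻ z∈
... | inj₁ refl = x∈q
... | inj₂ z∈p  = p⊆q z∈p

Subsingleton : Subset n → Set
Subsingleton p = ∀ {x y} → x ∈ p → y ∈ p → x ≡ y

⁅x⁆-subsingleton : ∀ (x : Fin n) → Subsingleton ⁅ x ⁆
⁅x⁆-subsingleton x y∈ z∈ = trans (x∈⁅y⁆⇒x≡y x y∈) (sym (x∈⁅y⁆⇒x≡y x z∈))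

-- nth p j is the singleton of the j-th element of p, and empty for j ≥ ∣ p ∣.
nth : Subset n → ℕ → Subset n
nth []            j       = []
nth (outside ∷ p) j       = outside ∷ nth p j
nth (inside  ∷ p) zero    = ⁅ zero ⁆
nth (inside  ∷ p) (suc j) = outside ∷ nth p j

nth-⊆ : ∀ (p : Subset n) j → nth p j ⊆ p
nth-⊆ (outside ∷ p) j       (there x∈) = there (nth-⊆ p j x∈)
nth-⊆ (inside  ∷ p) zero    here       = here
nth-⊆ (inside  ∷ p) zero    (there x∈) = contradiction x∈ ∉⊥
nth-⊆ (inside  ∷ p) (suc j) (there x∈) = there (nth-⊆ p j x∈)

nth-subsingleton : ∀ (p : Subset n) j → Subsingleton (nth p j)
nth-subsingleton (outside ∷ p) j       (there x∈) (there y∈) = cong suc (nth-subsingleton p j x∈ y∈)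
nth-subsingleton (inside  ∷ p) zero    x∈         y∈         = ⁅x⁆-subsingleton zero x∈ y∈
nth-subsingleton (inside  ∷ p) (suc j) (there x∈) (there y∈) = cong suc (nth-subsingleton p j x∈ y∈)

nth-index-unique : ∀ (p : Subset n) i j {x} → x ∈ nth p i → x ∈ nth p j → i ≡ j
nth-index-unique (outside ∷ p) i       j       (there a) (there b) = nth-index-unique p i j a b
nth-index-unique (inside  ∷ p) zero    zero    _         _         = refl
nth-index-unique (inside  ∷ p) zero    (suc j) (there a) _         = contradiction a ∉⊥
nth-index-unique (inside  ∷ p) (suc i) zero    _         (there b) = contradiction b ∉⊥
nth-index-unique (inside  ∷ p) (suc i) (suc j) (there a) (there b) =
  cong suc (nth-index-unique p i j a b)

nth-covers : ∀ {p : Subset n} {x} → x ∈ p → ∃ λ j → j < ∣ p ∣ × x ∈ nth p j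
nth-covers {p = inside ∷ p} here = zero , s≤s z≤n , here
nth-covers {p = inside ∷ p} (there x∈p) =
  let j , j<∣p∣ , x∈ = nth-covers x∈p in suc j , s≤s j<∣p∣ , there x∈
nth-covers {p = outside ∷ p} (there x∈p) =
  let j , j<∣p∣ , x∈ = nth-covers x∈p in j , j<∣p∣ , there x∈

avoid : ∀ (T : Subset n) (B : Fin k → Subset n) → (∀ j → Subsingleton (T ∩ B j)) →
        k < ∣ T ∣ → ∃ λ x → x ∈ T × ∀ j → x ∉ B j
avoid {k = zero} T B _ 0<∣T∣ = let x , x∈T = 0<∣p∣⇒Nonempty 0<∣T∣ in x , x∈T , λ ()
avoid {k = suc k} T B once k<∣T∣ with any? (λ y → y ∈? T ×-dec y ∈? B zero)
... | no ∄y =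
  let x , x∈T , x∉B = avoid T (B ∘ suc) (once ∘ suc) (<⇒≤ k<∣T∣)
      x∉B₀ x∈B₀ = ∄y (x , x∈T , x∈B₀)
  in x , x∈T , λ { zero → x∉B₀ ; (suc j) → x∉B j }
... | yes (y , y∈T , y∈B₀) =
  let x , x∈T-y , x∉B = avoid (T - y) (B ∘ suc) once′ (≤-pred (subst (_ <_) (x∈p⇒∣p∣≡1+∣p-x∣ y∈T) k<∣T∣))
      x∈T = p─q⊆p T ⁅ y ⁆ x∈T-y
      x∉B₀ x∈B₀ = x∉⁅y⁆⇒x≢y (x∈p─q⇒x∉q x∈T-y) (once zero (x∈p∩q⁺ (x∈T , x∈B₀)) (x∈p∩q⁺ (y∈T , y∈B₀)))
  in x , x∈T , λ { zero → x∉B₀ ; (suc j) → x∉B j }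
  where
  once′ : ∀ j → Subsingleton ((T - y) ∩ B (suc j))
  once′ j a b = once (suc j) (shrink a) (shrink b)
    where
    shrink : ∀ {x} → x ∈ (T - y) ∩ B (suc j) → x ∈ T ∩ B (suc j)
    shrink x∈ = let x∈T-y , x∈B = x∈p∩q⁻ (T - y) _ x∈ in x∈p∩q⁺ (p─q⊆p T ⁅ y ⁆ x∈T-y , x∈B)

avoid-except : ∀ (T : Subset n) (B : Fin k → Subset n) (i : Fin k) →
               (∀ j → Subsingleton (T ∩ B j)) → k ≤ ∣ T ∣ →
               ∃ λ x → x ∈ T × ∀ j → j ≢ i → x ∉ B j
avoid-except {k = suc k} T B i once k<∣T∣ =
  let x , x∈T , x∉B = avoid T (B ∘ punchIn i) (once ∘ punchIn i) k<∣T∣ in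
  x , x∈T , λ j j≢i → subst (λ j → x ∉ B j) (punchIn-punchOut (j≢i ∘ sym)) (x∉B (punchOut (j≢i ∘ sym)))

module _ {P : Pred (Subset n) ℓ} (P? : Decidable P) where

  extend-maximal : ∀ {S} → P S → ∃ λ M → S ⊆ M × P M × (∀ x → x ∉ M → ¬ P (⁅ x ⁆ ∪ M))
  extend-maximal {S} pS = go pS (<-wellFounded (n ∸ ∣ S ∣))
    where
    go : ∀ {S} → P S → Acc _<_ (n ∸ ∣ S ∣) →
         ∃ λ M → S ⊆ M × P M × (∀ x → x ∉ M → ¬ P (⁅ x ⁆ ∪ M))
    go {S} pS (acc rec) with any? (λ x → ¬? (x ∈? S) ×-dec P? (⁅ x ⁆ ∪ S))
    ... | no ∄x = S , ⊆-refl , pS , λ x x∉S pxS → ∄x (x , x∉S , pxS)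
    ... | yes (x , x∉S , pxS) =
      let M , xS⊆M , pM , maximal = go pxS (rec shrink) in M , xS⊆M ∘ q⊆p∪q ⁅ x ⁆ S , pM , maximal
      where
      shrink : n ∸ ∣ ⁅ x ⁆ ∪ S ∣ < n ∸ ∣ S ∣
      shrink = ∸-monoʳ-< (≤-reflexive (sym (x∉p⇒∣⁅x⁆∪p∣≡1+∣p∣ x∉S))) (∣p∣≤n (⁅ x ⁆ ∪ S))

  minimum : (f : Subset n → ℕ) → ∃ P → ∃ λ S → P S × ∀ T → P T → f S ≤ f T
  minimum f (S , pS) = go pS (<-wellFounded (f S))
    where
    go : ∀ {S} → P S → Acc _<_ (f S) → ∃ λ S → P S × ∀ T → P T → f S ≤ f T
    go {S} pS (acc rec) with anySubset? (λ T → P? T ×-dec f T <? f S)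
    ... | no ∄T = S , pS , λ T pT → ≮⇒≥ (λ fT<fS → ∄T (T , pT , fT<fS))
    ... | yes (T , pT , fT<fS) = go pT (rec fT<fS)

subset : ∀ {P : Pred (Fin n) ℓ} → Decidable P → Subset n
subset {n = zero}  P? = []
subset {n = suc n} P? = does (P? zero) ∷ subset (P? ∘ suc)

∈-subset⁺ : ∀ {P : Pred (Fin n) ℓ} (P? : Decidable P) {x} → P x → x ∈ subset P?
∈-subset⁺ P? {zero} px with P? zero
... | yes _   = here
... | no ¬px = contradiction px ¬px
∈-subset⁺ P? {suc x} px = there (∈-subset⁺ (P? ∘ suc) px)

∈-subset⁻ : ∀ {P : Pred (Fin n) ℓ} (P? : Decidable P) {x} → x ∈ subset P? → P x
∈-subset⁻ P? {zero} x∈ with P? zero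
∈-subset⁻ P? {zero} x∈ | yes px = px
∈-subset⁻ P? {zero} () | no _
∈-subset⁻ P? {suc x} (there x∈) = ∈-subset⁻ (P? ∘ suc) x∈

updateAt-elim : ∀ {a p} {A : Set a} (P : Fin k → A → Set p) (B : Fin k → A) i {f : A → A} →
                P i (f (B i)) → (∀ j → j ≢ i → P j (B j)) → ∀ j → P j (updateAt B i f j)
updateAt-elim P B i Pi Pj j with j ≟ᶠ i
... | yes refl = subst (P i) (sym (updateAt-updates i B)) Pi
... | no j≢i  = subst (P j) (sym (updateAt-minimal j i B j≢i)) (Pj j j≢i)

module _ (G : Graph n) where

  independent? : Decidable (Independent G)
  independent? S = all? λ x → all? λ y → x ∈? S →-dec (y ∈? S →-dec adj G x y Bool.≟ false)

  disjoint? : ∀ A B → Dec (Disjoint G A B)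
  disjoint? A B = all? λ x → x ∈? A →-dec ¬? (x ∈? B)

  independent-⊆ : ∀ {S T} → T ⊆ S → Independent G S → Independent G T
  independent-⊆ T⊆S indS x y x∈T y∈T = indS x y (T⊆S x∈T) (T⊆S y∈T)

  subsingleton⇒independent : ∀ {S} → Subsingleton S → Independent G S
  subsingleton⇒independent single x y x∈S y∈S =
    subst (λ z → adj G z y ≡ false) (sym (single x∈S y∈S)) (irrefl G y)

  independent-insert : ∀ {x S} → Independent G S → (∀ y → y ∈ S → adj G x y ≡ false) →
                       Independent G (⁅ x ⁆ ∪ S)
  independent-insert {x} indS x-nonadj u v u∈ v∈ with x∈⁅y⁆∪p⁻ u∈ | x∈⁅y⁆∪p⁻ v∈
  ... | inj₁ refl | inj₁ refl = irrefl G x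
  ... | inj₁ refl | inj₂ v∈S  = x-nonadj v v∈S
  ... | inj₂ u∈S  | inj₁ refl = trans (Graph.sym G u x) (x-nonadj u u∈S)
  ... | inj₂ u∈S  | inj₂ v∈S  = indS u v u∈S v∈S

  independent-insert₂ : ∀ {x y S} → Independent G (⁅ x ⁆ ∪ S) → Independent G (⁅ y ⁆ ∪ S) →
                        adj G x y ≡ false → Independent G (⁅ x ⁆ ∪ (⁅ y ⁆ ∪ S))
  independent-insert₂ {x} {y} {S} indxS indyS xy-nonadj = independent-insert indyS x-nonadj
    where
    x-nonadj : ∀ z → z ∈ ⁅ y ⁆ ∪ S → adj G x z ≡ false
    x-nonadj z z∈ with x∈⁅y⁆∪p⁻ z∈
    ... | inj₁ refl = xy-nonadj
    ... | inj₂ z∈S  = indxS x z (x∈⁅x⁆∪p x) (q⊆p∪q ⁅ x ⁆ S z∈S)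

  disjoint-insert : ∀ {x Y B} → x ∉ B → Disjoint G Y B → Disjoint G (⁅ x ⁆ ∪ Y) B
  disjoint-insert x∉B Y∩B=∅ z z∈ z∈B with x∈⁅y⁆∪p⁻ z∈
  ... | inj₁ refl = x∉B z∈B
  ... | inj₂ z∈Y  = Y∩B=∅ z z∈Y z∈B

  record Packing (B : Fin k → Subset n) : Set where
    field
      independent : ∀ j → Independent G (B j)
      disjoint    : ∀ i j → i ≢ j → Disjoint G (B i) (B j)

  packing-update : ∀ {B : Fin k → Subset n} {Y} i → Packing B → Independent G Y →
                   (∀ j → j ≢ i → Disjoint G Y (B j)) → Packing (updateAt B i (const Y))
  packing-update {B = B} {Y} i pB indY Y∩B=∅ = record
    { independent = updateAt-elim (λ _ → Independent G) B i indY (λ j _ → independent j)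
    ; disjoint    = disjoint′
    }
    where
    open Packing pB
    B′ = updateAt B i (const Y)

    Y-disjoint-B′ : ∀ j → i ≢ j → Disjoint G Y (B′ j)
    Y-disjoint-B′ = updateAt-elim (λ j Z → i ≢ j → Disjoint G Y Z) B i
      (λ i≢i → contradiction refl i≢i) (λ j j≢i _ → Y∩B=∅ j j≢i)

    B-disjoint-B′ : ∀ j → j ≢ i → ∀ j′ → j ≢ j′ → Disjoint G (B j) (B′ j′)
    B-disjoint-B′ j j≢i = updateAt-elim (λ j′ Z → j ≢ j′ → Disjoint G (B j) Z) B i
      (λ _ x x∈Bj x∈Y → Y∩B=∅ j j≢i x x∈Y x∈Bj) (λ j′ _ → disjoint j j′)

    disjoint′ : ∀ j j′ → j ≢ j′ → Disjoint G (B′ j) (B′ j′)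
    disjoint′ j j′ = updateAt-elim (λ j Z → j ≢ j′ → Disjoint G Z (B′ j′)) B i
      (Y-disjoint-B′ j′) (λ j j≢i → B-disjoint-B′ j j≢i j′) j

  -- If k > ∣ T ∣, then S and the singletons of T would extend to k disjoint maximum sets,
  -- but the one containing S meets T.
  InW⇒≤∣transversal∣ : ∀ {r S T} → InW G r k → Independent G S → (∀ x → x ∈ T → x ∉ S) →
                       (∀ M → MaximumIndependent G r M → S ⊆ M → ∃ λ y → y ∈ M × y ∈ T) →
                       k ≤ ∣ T ∣
  InW⇒≤∣transversal∣ {k = zero} _ _ _ _ = z≤n
  InW⇒≤∣transversal∣ {k = suc k} {S = S} {T} (_ , extend) indS T∩S=∅ meets with k <? ∣ T ∣
  ... | yes k<∣T∣ = k<∣T∣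
  ... | no k≮∣T∣ =
    let M , maxM , A⊆M , M-disjoint = extend A A-independent A-disjoint
        y , y∈M₀ , y∈T = meets (M zero) (maxM zero) (A⊆M zero)
        j , j<∣T∣ , y∈nth = nth-covers y∈T
        j′ = fromℕ< (<-≤-trans j<∣T∣ (≮⇒≥ k≮∣T∣))
        y∈Aj′ = subst (λ j → y ∈ nth T j) (sym (toℕ-fromℕ< _)) y∈nth
    in ⊥-elim (M-disjoint zero (suc j′) (λ ()) y y∈M₀ (A⊆M (suc j′) y∈Aj′))
    where
    A : Fin (suc k) → Subset n
    A zero    = S
    A (suc j) = nth T (toℕ j)

    A-independent : ∀ j → Independent G (A j)
    A-independent zero    = indS
    A-independent (suc j) = subsingleton⇒independent (nth-subsingleton T (toℕ j))

    A-disjoint : ∀ i j → i ≢ j → Disjoint G (A i) (A j)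
    A-disjoint zero    zero    0≢0 = contradiction refl 0≢0
    A-disjoint zero    (suc j) _   x x∈S x∈T = T∩S=∅ x (nth-⊆ T (toℕ j) x∈T) x∈S
    A-disjoint (suc i) zero    _   x x∈T x∈S = T∩S=∅ x (nth-⊆ T (toℕ i) x∈T) x∈S
    A-disjoint (suc i) (suc j) i≢j x a b =
      i≢j (cong suc (toℕ-injective (nth-index-unique T (toℕ i) (toℕ j) a b)))

-- Well-covered graphs; r stands for α(G) − 1, so that the statement's r ∸ 1 is just r.

module WellCoveredGraph (G : Graph n) (r : ℕ)
  (bound : ∀ S → Independent G S → ∣ S ∣ ≤ suc r) (wc : WellCovered G (suc r)) where

  Maximum : Subset n → Set
  Maximum = MaximumIndependent G (suc r)

  AlmostMaximum : Subset n → Set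
  AlmostMaximum S = Independent G S × ∣ S ∣ ≡ r

  almostMaximum? : Decidable AlmostMaximum
  almostMaximum? S = independent? G S ×-dec ∣ S ∣ ℕ.≟ r

  maximum-⊆ : ∀ {X Y} → Maximum X → X ⊆ Y → Independent G Y → Maximum Y
  maximum-⊆ {Y = Y} (_ , ∣X∣≡) X⊆Y indY =
    indY , ≤-antisym (bound Y indY) (subst (_≤ ∣ Y ∣) ∣X∣≡ (p⊆q⇒∣p∣≤∣q∣ X⊆Y))

  extend-to-maximum : ∀ {S} → Independent G S → ∃ λ M → S ⊆ M × Maximum M
  extend-to-maximum indS =
    let M , S⊆M , indM , maximal = extend-maximal (independent? G) indS
    in M , S⊆M , indM , wc M (indM , maximal)

  maximum-minus : ∀ {M y} → Maximum M → y ∈ M → AlmostMaximum (M - y)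
  maximum-minus {M} (indM , ∣M∣≡) y∈M =
    independent-⊆ G (p─q⊆p M _) indM , suc-injective (trans (sym (x∈p⇒∣p∣≡1+∣p-x∣ y∈M)) ∣M∣≡)

  almostMaximum-exists : ∀ {M} → Maximum M → ∃ AlmostMaximum
  almostMaximum-exists {M} maxM =
    let y , y∈M = 0<∣p∣⇒Nonempty (subst (0 <_) (sym (proj₂ maxM)) (s≤s z≤n))
    in M - y , maximum-minus maxM y∈M

  almostMaximum-⊇ : ∀ {X} → Independent G X → ∣ X ∣ < suc r → ∃ λ S → X ⊆ S × AlmostMaximum S
  almostMaximum-⊇ {X} indX ∣X∣< =
    let M , X⊆M , maxM = extend-to-maximum indX
        y , y∈M , y∉X = ∣p∣<∣q∣⇒∃∈q∉p (subst (∣ X ∣ <_) (sym (proj₂ maxM)) ∣X∣<)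
        X⊆M-y : X ⊆ M - y
        X⊆M-y x∈X = x∈p∧x≢y⇒x∈p-y (X⊆M x∈X) (λ x≡y → y∉X (subst (_∈ X) x≡y x∈X))
    in M - y , X⊆M-y , maximum-minus maxM y∈M

  completes? : ∀ S x → Dec (x ∉ S × Maximum (⁅ x ⁆ ∪ S))
  completes? S x = ¬? (x ∈? S) ×-dec (independent? G (⁅ x ⁆ ∪ S) ×-dec ∣ ⁅ x ⁆ ∪ S ∣ ℕ.≟ suc r)

  F : Subset n → Subset n
  F S = subset (completes? S)

  F-isF : ∀ S → IsF G (suc r) S (F S)
  F-isF S x = mk⇔ (∈-subset⁻ (completes? S)) (∈-subset⁺ (completes? S))

  IsF⇒∣F∣ : ∀ {S T} → IsF G (suc r) S T → ∣ T ∣ ≡ ∣ F S ∣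
  IsF⇒∣F∣ {S} T-isF = cong ∣_∣ (⊆-antisym
    (λ {x} x∈T → ∈-subset⁺ (completes? S) (Equivalence.to (T-isF x) x∈T))
    (λ {x} x∈F → Equivalence.from (T-isF x) (∈-subset⁻ (completes? S) x∈F)))

  -- Two non-adjacent vertices of F S would extend S to an independent set of size α(G) + 1.
  F-clique : ∀ {S x y} → x ∈ F S → y ∈ F S → adj G x y ≡ false → x ≡ y
  F-clique {S} {x} {y} x∈F y∈F xy-nonadj
    with x∉S , indxS , _ ← ∈-subset⁻ (completes? S) x∈F
       | _ , indyS , ∣yS∣≡ ← ∈-subset⁻ (completes? S) y∈F
    = decidable-stable (x ≟ᶠ y) λ x≢y →
        let size = trans (x∉p⇒∣⁅x⁆∪p∣≡1+∣p∣ (x∉⁅y⁆∪p x≢y x∉S)) (cong suc ∣yS∣≡)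
        in contradiction (bound _ (independent-insert₂ G indxS indyS xy-nonadj))
                         (<⇒≱ (≤-reflexive (sym size)))

  F-meets-maximum : ∀ {S M} → AlmostMaximum S → S ⊆ M → Maximum M → ∃ λ y → y ∈ M × y ∈ F S
  F-meets-maximum {S} {M} (_ , ∣S∣≡r) S⊆M (indM , ∣M∣≡) =
    let y , y∈M , y∉S = ∣p∣<∣q∣⇒∃∈q∉p (subst₂ _<_ (sym ∣S∣≡r) (sym ∣M∣≡) ≤-refl)
    in y , y∈M , ∈-subset⁺ (completes? S)
         ( y∉S , independent-⊆ G (⁅x⁆∪p⊆q y∈M S⊆M) indM
         , trans (x∉p⇒∣⁅x⁆∪p∣≡1+∣p∣ y∉S) (cong suc ∣S∣≡r))

  F-nonempty : ∀ {S} → AlmostMaximum S → 0 < ∣ F S ∣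
  F-nonempty qS =
    let M , S⊆M , maxM = extend-to-maximum (proj₁ qS)
    in x∈p⇒0<∣p∣ (proj₂ (proj₂ (F-meets-maximum qS S⊆M maxM)))

  module _ (k≤∣F∣ : ∀ S → AlmostMaximum S → k ≤ ∣ F S ∣) where

    grow-avoiding : ∀ {B : Fin k → Subset n} → (∀ j → Independent G (B j)) → ∀ i {X} →
                    Independent G X → ∣ X ∣ < suc r →
                    ∃ λ x → x ∉ X × Independent G (⁅ x ⁆ ∪ X) × ∀ j → j ≢ i → x ∉ B j
    grow-avoiding {B} indB i {X} indX ∣X∣< =
      let S , X⊆S , qS = almostMaximum-⊇ indX ∣X∣<
          x , x∈F , x∉B = avoid-except (F S) B i F∩B-subsingleton (k≤∣F∣ S qS)
          x∉S , indxS , _ = ∈-subset⁻ (completes? S) x∈F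
      in x , x∉S ∘ X⊆S , independent-⊆ G (⁅x⁆∪p⊆q (x∈⁅x⁆∪p x) (q⊆p∪q ⁅ x ⁆ S ∘ X⊆S)) indxS , x∉B
      where
      F∩B-subsingleton : ∀ {S} j → Subsingleton (F S ∩ B j)
      F∩B-subsingleton {S} j a b =
        let a∈F , a∈B = x∈p∩q⁻ (F S) _ a
            b∈F , b∈B = x∈p∩q⁻ (F S) _ b
        in F-clique a∈F b∈F (indB j _ _ a∈B b∈B)

    extend-at : ∀ {B : Fin k → Subset n} → Packing G B → ∀ i →
                ∃ λ Y → B i ⊆ Y × Maximum Y × ∀ j → j ≢ i → Disjoint G Y (B j)
    extend-at {B} pB i =
      let Y , Bi⊆Y , pY , maximal = extend-maximal P? (independent i , λ j j≢i → disjoint i j (j≢i ∘ sym))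
      in Y , Bi⊆Y , maximal⇒maximum pY maximal , proj₂ pY
      where
      open Packing pB
      P : Subset n → Set
      P Y = Independent G Y × ∀ j → j ≢ i → Disjoint G Y (B j)

      P? : Decidable P
      P? Y = independent? G Y ×-dec all? λ j → ¬? (j ≟ᶠ i) →-dec disjoint? G Y (B j)

      maximal⇒maximum : ∀ {Y} → P Y → (∀ x → x ∉ Y → ¬ P (⁅ x ⁆ ∪ Y)) → Maximum Y
      maximal⇒maximum {Y} (indY , Y∩B=∅) maximal with ∣ Y ∣ ℕ.≟ suc r
      ... | yes ∣Y∣≡ = indY , ∣Y∣≡
      ... | no ∣Y∣≢ =
        let x , x∉Y , indxY , x∉B = grow-avoiding independent i indY (≤∧≢⇒< (bound Y indY) ∣Y∣≢)
        in contradiction (indxY , λ j j≢i → disjoint-insert G (x∉B j j≢i) (Y∩B=∅ j j≢i)) (maximal x x∉Y)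

    extend-all : ∀ {B : Fin k → Subset n} (is : List (Fin k)) → Packing G B →
                 ∃ λ B′ → Packing G B′ × (∀ j → B j ⊆ B′ j) × All (Maximum ∘ B′) is
    extend-all [] pB = _ , pB , (λ _ → ⊆-refl) , []
    extend-all {B} (i ∷ is) pB =
      let Y , Bi⊆Y , maxY , Y∩B=∅ = extend-at pB i
          B₁ = updateAt B i (const Y)
          pB₁ = packing-update G i pB (proj₁ maxY) Y∩B=∅
          B⊆B₁ = updateAt-elim (λ j Z → B j ⊆ Z) B i Bi⊆Y (λ _ _ → ⊆-refl)
          B₂ , pB₂ , B₁⊆B₂ , maxB₂ = extend-all is pB₁
          maxB₁i = subst Maximum (sym (updateAt-updates i B)) maxY
      in B₂ , pB₂ , (λ j → B₁⊆B₂ j ∘ B⊆B₁ j)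
       , maximum-⊆ maxB₁i (B₁⊆B₂ i) (Packing.independent pB₂ i) ∷ maxB₂

    InW-sufficient : k ≤ n → InW G (suc r) k
    InW-sufficient k≤n = k≤n , λ A indA disA →
      let B , pB , A⊆B , maxB = extend-all (allFin _) (record { independent = indA ; disjoint = disA })
      in B , (λ j → All.lookup maxB (∈-allFin j)) , A⊆B , Packing.disjoint pB

  InW-necessary : ∀ {S} → InW G (suc r) k → AlmostMaximum S → k ≤ ∣ F S ∣
  InW-necessary {S = S} w qS = InW⇒≤∣transversal∣ G w (proj₁ qS)
    (λ x x∈F → proj₁ (∈-subset⁻ (completes? S) x∈F))
    (λ M maxM S⊆M → F-meets-maximum qS S⊆M maxM)

corollary3p2 : ∀ {n} (G : Graph n) (r : ℕ) → 1 ≤ n →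
    IndependenceNumber G r → WellCovered G r →
    ∃ λ m → IsMinF G r m × IsWNumber G r m
corollary3p2 G zero (s≤s z≤n) (_ , bound) _ =
  contradiction (bound ⁅ zero ⁆ (subsingleton⇒independent G (⁅x⁆-subsingleton zero))) λ ()
corollary3p2 G (suc r) _ ((W , maxW) , bound) wc =
  let open WellCoveredGraph G r bound wc
      S , (indS , ∣S∣≡r) , minimal = minimum almostMaximum? (∣_∣ ∘ F) (almostMaximum-exists maxW)
      least S′ T indS′ ∣S′∣≡r T-isF =
        subst (∣ F S ∣ ≤_) (sym (IsF⇒∣F∣ T-isF)) (minimal S′ (indS′ , ∣S′∣≡r))
  in ∣ F S ∣
   , ((S , F S , indS , ∣S∣≡r , F-isF S , refl) , least)
   , (F-nonempty (indS , ∣S∣≡r) , InW-sufficient minimal (∣p∣≤n (F S))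
     , λ _ _ w → InW-necessary w (indS , ∣S∣≡r))
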